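{- Let $H$ be a finite $3$-uniform hypergraph and let $M$ be a maximum $2$-matching in $H$. If there exists $e \in M$ such that $\sum_{v \in e} d_M(v) \leq 4$ and $\tau^{(2)}(S_e) = 1$, then $$\tau^{(2)}(H) \leq 4 + \left(\nu^{(2)}(H) - 2\right) g_{\nu^{(2)}(H)-2}(3, 2).$$
   Context: For a $3$-uniform hypergraph $H$ with vertex set $V$: a $2$-matching is a set $M$ of edges with $|e \cap e'| < 2$ for all distinct $e,e' \in M$, and $\nu^{(2)}(H)$ is its maximum size. A $2$-cover is a set $C$ of $2$-subsets of $V$ such that every edge contains a member of $C$; $\tau^{(2)}$ of a set of edges is the minimum size of a $2$-cover of the hypergraph with that edge set. For a vertex $v$, $d_M(v)$ is the number of edges of $M$ containing $v$. For $e \in M$, $S_e = \{h \in E(H) : |e \cap h| \geq 2 \text{ and } |h \cap f| < 2 \text{ for all } f \in M \setminus \{e\}\}$. For $i \ge 1$, $g_i(k,m)$ is the supremum of $\tau^{(m)}(H')/\nu^{(m)}(H')$ over all finite $k$-uniform hypergraphs $H'$ with $\nu^{(m)}(H') = i$. -}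

module Defs where

open import Data.Nat using (ℕ; zero; suc; _+_; _*_; _∸_; _≤_; _<_)
open import Data.Bool using (true; false; if_then_else_)
open import Data.Fin using (Fin)
open import Data.Fin.Subset using (Subset; _∩_; _⊆_; ∣_∣)
open import Data.Vec using (lookup)
open import Data.List using (List; []; _∷_; length; map; allFin)
open import Data.Nat.ListAction using (sum)
open import Data.List.Relation.Unary.All using (All)
open import Data.List.Relation.Unary.Any using (Any)
open import Data.List.Relation.Unary.AllPairs using (AllPairs)
open import Data.List.Membership.Propositional using (_∈_)
open import Data.Product using (Σ; _×_)
open import Relation.Nullary using (¬_)
open import Relation.Binary.PropositionalEquality using (_≡_)

record Hyp3 (n : ℕ) : Set where
  field
    edges   : List (Subset n)
    uniform : All (λ e → ∣ e ∣ ≡ 3) edges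
open Hyp3 public

InH : ∀ {n} → Hyp3 n → Subset n → Set
InH H h = h ∈ edges H

-- 2-matching: a list of edges of H that pairwise meet in fewer than 2 vertices
-- (this forces the listed edges to be distinct, so |M| = length M).
IsTwoMatching : ∀ {n} → Hyp3 n → List (Subset n) → Set
IsTwoMatching H M = All (InH H) M × AllPairs (λ e f → ∣ e ∩ f ∣ < 2) M

IsMaxTwoMatching : ∀ {n} → Hyp3 n → List (Subset n) → Set
IsMaxTwoMatching H M =
  IsTwoMatching H M × (∀ M′ → IsTwoMatching H M′ → length M′ ≤ length M)

NuTwo : ∀ {n} → Hyp3 n → ℕ → Set
NuTwo H k =
  Σ (List _) (λ M → IsTwoMatching H M × length M ≡ k)
  × (∀ M → IsTwoMatching H M → length M ≤ k)

IsTwoCover : ∀ {n} → (Subset n → Set) → List (Subset n) → Set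
IsTwoCover E C = All (λ c → ∣ c ∣ ≡ 2) C × (∀ h → E h → Any (λ c → c ⊆ h) C)

TauTwo : ∀ {n} → (Subset n → Set) → ℕ → Set
TauTwo E k =
  Σ (List _) (λ C → IsTwoCover E C × length C ≡ k)
  × (∀ C → IsTwoCover E C → k ≤ length C)

degM : ∀ {n} → List (Subset n) → Fin n → ℕ
degM [] v = 0
degM (f ∷ M) v = (if lookup f v then 1 else 0) + degM M v

degSum : ∀ {n} → List (Subset n) → Subset n → ℕ
degSum {n} M e = sum (map (λ v → if lookup e v then degM M v else 0) (allFin n))

S : ∀ {n} → Hyp3 n → List (Subset n) → Subset n → Subset n → Set
S H M e h = InH H h × 2 ≤ ∣ e ∩ h ∣ × (∀ f → f ∈ M → ¬ (f ≡ e) → ∣ h ∩ f ∣ < 2)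

-- The rational number p/q is an upper bound for τ^(2)(H')/ν^(2)(H') over all
-- finite 3-uniform H' with ν^(2)(H') = i, i.e. τ^(2)(H') ≤ (p/q)·i for all such H'.
-- (Then g_i(3,2) is the least such bound.)
GUpperBound : ℕ → ℕ → ℕ → Set
GUpperBound i p q =
  ∀ (n′ : ℕ) (H′ : Hyp3 n′) → NuTwo H′ i →
    Σ (List (Subset n′)) (λ C → IsTwoCover (InH H′) C × q * length C ≤ p * i)

{-# OPTIONS --safe #-}
-- Since Σ_{v ∈ e} d_M(v) = Σ_{g ∈ M} |e ∩ g| = 3 + Σ_{g ∈ M ∖ e} |e ∩ g| ≤ 4, at most one
-- edge of M ∖ e meets e, so M ∖ e splits as f together with edges disjoint from e.  The
-- edges of H meeting both e and f in fewer than two vertices form a hypergraph H′ with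
-- ν^(2)(H′) = ν − 2: it contains M ∖ {e, f}, and adding e and f to a larger 2-matching of
-- H′ would beat M.  Cover H′ by C′ with q|C′| ≤ p(ν − 2), cover the edges meeting f in two
-- vertices by the three pairs of f, and note that every other edge h meets e in two
-- vertices; having only one vertex outside e, it meets each edge disjoint from e at most
-- once, so h ∈ S_e and the single pair covering S_e covers it.
module Submission where

open import Defs
open import Data.Nat using (ℕ; suc; _+_; _*_; _∸_; _≤_; _<_; z≤n; s≤s; s≤s⁻¹; _≟_; _≤?_; _<?_)
open import Data.Nat.Properties
open import Data.Bool using (Bool; true; false; if_then_else_; _∧_)
open import Data.Fin.Subset using (Subset; _∩_; _⊆_; ∣_∣)
open import Data.Fin.Subset.Properties using (∩-comm; ∩-idem; ∣p∩q∣≤∣p∣; out⊆; in⊆in; ⊆-refl)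
open import Data.Vec using ([]; _∷_; lookup)
open import Data.Vec.Properties using (lookup-zipWith)
open import Data.List using (List; []; _∷_; _++_; length; map; filter; allFin; tabulate)
open import Data.List.Properties using (length-map; length-++; map-cong; map-tabulate)
open import Data.Nat.ListAction using (sum)
open import Data.Nat.ListAction.Properties using (sum-↭)
open import Data.List.Relation.Unary.All as All using (All; []; _∷_)
import Data.List.Relation.Unary.All.Properties as Allₚ
open import Data.List.Relation.Unary.Any as Any using (Any; here; there)
import Data.List.Relation.Unary.Any.Properties as Anyₚ
open import Data.List.Relation.Unary.AllPairs using (AllPairs; []; _∷_)
import Data.List.Relation.Unary.AllPairs.Properties as AllPairs
open import Data.List.Membership.Propositional using (_∈_)
open import Data.List.Membership.Propositional.Properties using (∈-∃++; ∈-filter⁺; ∈-filter⁻)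
open import Data.List.Relation.Binary.Permutation.Propositional
  using (_↭_; ↭-refl; ↭-prep; ↭-swap; ↭-trans; ↭-sym; ↭⇒↭ₛ)
open import Data.List.Relation.Binary.Permutation.Propositional.Properties
  using (∈-resp-↭; All-resp-↭; ↭-length; shift; ++-comm)
  renaming (map⁺ to ↭-map⁺)
import Data.List.Relation.Binary.Permutation.Setoid.Properties as Permutationₛ
open import Function using (id; _∘_)
open import Data.Product using (Σ; ∃₂; _×_; _,_; proj₁; proj₂)
open import Data.Empty using (⊥-elim)
open import Relation.Nullary using (¬_; Dec; yes; no)
open import Relation.Binary.PropositionalEquality
open import Algebra.Properties.CommutativeSemigroup +-commutativeSemigroup using (interchange)

private
  variable
    A : Set
    n : ℕ

sum-map-+ : (f g : A → ℕ) (xs : List A) →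
  sum (map (λ x → f x + g x) xs) ≡ sum (map f xs) + sum (map g xs)
sum-map-+ f g [] = refl
sum-map-+ f g (x ∷ xs) =
  trans (cong (f x + g x +_) (sum-map-+ f g xs)) (interchange (f x) (g x) _ _)

sum-map-0 : (xs : List A) → sum (map (λ _ → 0) xs) ≡ 0
sum-map-0 [] = refl
sum-map-0 (_ ∷ xs) = sum-map-0 xs

sum-map≡0⇒All≡0 : (w : A → ℕ) (xs : List A) →
  sum (map w xs) ≡ 0 → All (λ x → w x ≡ 0) xs
sum-map≡0⇒All≡0 w [] _ = []
sum-map≡0⇒All≡0 w (x ∷ xs) eq =
  m+n≡0⇒m≡0 (w x) eq ∷ sum-map≡0⇒All≡0 w xs (m+n≡0⇒n≡0 (w x) eq)

∈⇒↭∷ : ∀ {x : A} {xs} → x ∈ xs → Σ (List A) λ ys → xs ↭ x ∷ ys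
∈⇒↭∷ x∈xs with ys , zs , refl ← ∈-∃++ x∈xs = ys ++ zs , shift _ ys zs

sum≤1⇒↭∷zeros : (w : A → ℕ) (xs : List A) → 0 < length xs → sum (map w xs) ≤ 1 →
  ∃₂ λ y ys → xs ↭ y ∷ ys × All (λ z → w z ≡ 0) ys
sum≤1⇒↭∷zeros w (x ∷ []) _ _ = x , [] , ↭-refl , []
sum≤1⇒↭∷zeros w (x ∷ xs@(_ ∷ _)) _ s≤1
  with w x ≟ 0 | sum≤1⇒↭∷zeros w xs (s≤s z≤n) (m+n≤o⇒n≤o (w x) s≤1)
... | yes wx≡0 | y , ys , xs↭ , zeros =
  y , x ∷ ys , ↭-trans (↭-prep x xs↭) (↭-swap x y ↭-refl) , wx≡0 ∷ zeros
... | no wx≢0 | _ = x , xs , ↭-refl , sum-map≡0⇒All≡0 w xs (n≤0⇒n≡0 (s≤s⁻¹ 1+sum≤1))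
  where
  1+sum≤1 : 1 + sum (map w xs) ≤ 1
  1+sum≤1 = ≤-trans (+-monoˡ-≤ _ (n≢0⇒n>0 wx≢0)) s≤1

module _ {R : A → A → Set} where

  AllPairs-++⁻ : ∀ xs {ys} → AllPairs R (xs ++ ys) →
    AllPairs R xs × AllPairs R ys × All (λ x → All (R x) ys) xs
  AllPairs-++⁻ [] rs = [] , rs , []
  AllPairs-++⁻ (x ∷ xs) (rx ∷ rs) =
    let rxs , rys , cross = AllPairs-++⁻ xs rs
    in Allₚ.++⁻ˡ xs rx ∷ rxs , rys , Allₚ.++⁻ʳ xs rx ∷ cross

  AllPairs-resp-↭ : (∀ {x y} → R x y → R y x) →
    ∀ {xs ys} → xs ↭ ys → AllPairs R xs → AllPairs R ys
  AllPairs-resp-↭ sym p = Permutationₛ.AllPairs-resp-↭ (setoid A) sym (resp₂ R) (↭⇒↭ₛ p)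

∣p∩q∣+∣q∩r∣≤∣q∣+∣p∩r∣ : (p q r : Subset n) → ∣ p ∩ q ∣ + ∣ q ∩ r ∣ ≤ ∣ q ∣ + ∣ p ∩ r ∣
∣p∩q∣+∣q∩r∣≤∣q∣+∣p∩r∣ [] [] [] = z≤n
∣p∩q∣+∣q∩r∣≤∣q∣+∣p∩r∣ (true ∷ p) (true ∷ q) (true ∷ r) =
  s≤s (subst₂ _≤_ (sym (+-suc _ _)) (sym (+-suc _ _)) (s≤s (∣p∩q∣+∣q∩r∣≤∣q∣+∣p∩r∣ p q r)))
∣p∩q∣+∣q∩r∣≤∣q∣+∣p∩r∣ (true ∷ p) (true ∷ q) (false ∷ r) =
  s≤s (∣p∩q∣+∣q∩r∣≤∣q∣+∣p∩r∣ p q r)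
∣p∩q∣+∣q∩r∣≤∣q∣+∣p∩r∣ (true ∷ p) (false ∷ q) (true ∷ r) =
  ≤-trans (∣p∩q∣+∣q∩r∣≤∣q∣+∣p∩r∣ p q r) (+-monoʳ-≤ ∣ q ∣ (n≤1+n _))
∣p∩q∣+∣q∩r∣≤∣q∣+∣p∩r∣ (true ∷ p) (false ∷ q) (false ∷ r) = ∣p∩q∣+∣q∩r∣≤∣q∣+∣p∩r∣ p q r
∣p∩q∣+∣q∩r∣≤∣q∣+∣p∩r∣ (false ∷ p) (true ∷ q) (true ∷ r) =
  subst (_≤ suc (∣ q ∣ + ∣ p ∩ r ∣)) (sym (+-suc _ _)) (s≤s (∣p∩q∣+∣q∩r∣≤∣q∣+∣p∩r∣ p q r))
∣p∩q∣+∣q∩r∣≤∣q∣+∣p∩r∣ (false ∷ p) (true ∷ q) (false ∷ r) =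
  m≤n⇒m≤1+n (∣p∩q∣+∣q∩r∣≤∣q∣+∣p∩r∣ p q r)
∣p∩q∣+∣q∩r∣≤∣q∣+∣p∩r∣ (false ∷ p) (false ∷ q) (true ∷ r) = ∣p∩q∣+∣q∩r∣≤∣q∣+∣p∩r∣ p q r
∣p∩q∣+∣q∩r∣≤∣q∣+∣p∩r∣ (false ∷ p) (false ∷ q) (false ∷ r) = ∣p∩q∣+∣q∩r∣≤∣q∣+∣p∩r∣ p q r

∣p∣≤∣p∩q∣⇒p⊆q : (p q : Subset n) → ∣ p ∣ ≤ ∣ p ∩ q ∣ → p ⊆ q
∣p∣≤∣p∩q∣⇒p⊆q [] [] _ = ⊆-refl
∣p∣≤∣p∩q∣⇒p⊆q (true ∷ p) (true ∷ q) le = in⊆in (∣p∣≤∣p∩q∣⇒p⊆q p q (s≤s⁻¹ le))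
∣p∣≤∣p∩q∣⇒p⊆q (true ∷ p) (false ∷ q) le = ⊥-elim (n≮n _ (≤-trans le (∣p∩q∣≤∣p∣ p q)))
∣p∣≤∣p∩q∣⇒p⊆q (false ∷ p) (_ ∷ q) le = out⊆ (∣p∣≤∣p∩q∣⇒p⊆q p q le)

facets : Subset n → List (Subset n)
facets [] = []
facets (true ∷ p) = (false ∷ p) ∷ map (true ∷_) (facets p)
facets (false ∷ p) = map (false ∷_) (facets p)

length-facets : (p : Subset n) → length (facets p) ≡ ∣ p ∣
length-facets [] = refl
length-facets (true ∷ p) = cong suc (trans (length-map _ (facets p)) (length-facets p))
length-facets (false ∷ p) = trans (length-map _ (facets p)) (length-facets p)

suc∣facet∣≡∣p∣ : (p : Subset n) → All (λ c → suc ∣ c ∣ ≡ ∣ p ∣) (facets p)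
suc∣facet∣≡∣p∣ [] = []
suc∣facet∣≡∣p∣ (true ∷ p) = refl ∷ Allₚ.map⁺ (All.map (cong suc) (suc∣facet∣≡∣p∣ p))
suc∣facet∣≡∣p∣ (false ∷ p) = Allₚ.map⁺ (suc∣facet∣≡∣p∣ p)

facets-cover : (p q : Subset n) → ∣ p ∣ ≤ suc ∣ p ∩ q ∣ → 0 < ∣ p ∣ → Any (_⊆ q) (facets p)
facets-cover (true ∷ p) (false ∷ q) le _ = here (out⊆ (∣p∣≤∣p∩q∣⇒p⊆q p q (s≤s⁻¹ le)))
facets-cover (true ∷ p) (true ∷ q) le _ with ∣ p ∣ ≤? ∣ p ∩ q ∣
... | yes p⊆q = here (out⊆ (∣p∣≤∣p∩q∣⇒p⊆q p q p⊆q))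
... | no p⊈q = there (Anyₚ.map⁺ (Any.map in⊆in
      (facets-cover p q (s≤s⁻¹ le) (≤-trans (s≤s z≤n) (≰⇒> p⊈q)))))
facets-cover (false ∷ p) (_ ∷ q) le 0<∣p∣ =
  Anyₚ.map⁺ (Any.map out⊆ (facets-cover p q le 0<∣p∣))

indicator-∩ : (a b : Bool) (d : ℕ) →
  (if a then (if b then 1 else 0) + d else 0) ≡ (if a ∧ b then 1 else 0) + (if a then d else 0)
indicator-∩ true true d = refl
indicator-∩ true false d = refl
indicator-∩ false b d = refl

∣p∣≡sum-indicator : (p : Subset n) →
  ∣ p ∣ ≡ sum (map (λ v → if lookup p v then 1 else 0) (allFin n))
∣p∣≡sum-indicator {n} p =
  trans (∣p∣≡sum-tabulate p) (cong sum (sym (map-tabulate id (λ v → if lookup p v then 1 else 0))))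
  where
  ∣p∣≡sum-tabulate : ∀ {n} (p : Subset n) →
    ∣ p ∣ ≡ sum (tabulate (λ v → if lookup p v then 1 else 0))
  ∣p∣≡sum-tabulate [] = refl
  ∣p∣≡sum-tabulate (true ∷ p) = cong suc (∣p∣≡sum-tabulate p)
  ∣p∣≡sum-tabulate (false ∷ p) = ∣p∣≡sum-tabulate p

degSum-[] : (e : Subset n) → degSum [] e ≡ 0
degSum-[] {n} e =
  trans (cong sum (map-cong (λ v → if-0 (lookup e v)) (allFin n))) (sum-map-0 (allFin n))
  where
  if-0 : (b : Bool) → (if b then 0 else 0) ≡ 0
  if-0 true = refl
  if-0 false = refl

degSum-∷ : (g : Subset n) (M : List (Subset n)) (e : Subset n) →
  degSum (g ∷ M) e ≡ ∣ e ∩ g ∣ + degSum M e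
degSum-∷ {n} g M e = begin
  degSum (g ∷ M) e
    ≡⟨ cong sum (map-cong pointwise (allFin n)) ⟩
  sum (map (λ v → (if lookup (e ∩ g) v then 1 else 0)
                 + (if lookup e v then degM M v else 0)) (allFin n))
    ≡⟨ sum-map-+ _ _ (allFin n) ⟩
  sum (map (λ v → if lookup (e ∩ g) v then 1 else 0) (allFin n)) + degSum M e
    ≡⟨ cong (_+ degSum M e) (sym (∣p∣≡sum-indicator (e ∩ g))) ⟩
  ∣ e ∩ g ∣ + degSum M e ∎
  where
  open ≡-Reasoning
  pointwise : ∀ v → (if lookup e v then degM (g ∷ M) v else 0)
                  ≡ (if lookup (e ∩ g) v then 1 else 0) + (if lookup e v then degM M v else 0)
  pointwise v = trans (indicator-∩ (lookup e v) (lookup g v) (degM M v))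
    (cong (λ b → (if b then 1 else 0) + _) (sym (lookup-zipWith _∧_ v e g)))

degSum≡sum : (M : List (Subset n)) (e : Subset n) → degSum M e ≡ sum (map (λ g → ∣ e ∩ g ∣) M)
degSum≡sum [] e = degSum-[] e
degSum≡sum (g ∷ M) e = trans (degSum-∷ g M e) (cong (∣ e ∩ g ∣ +_) (degSum≡sum M e))

degSum-↭∷ : {M M₁ : List (Subset n)} {e : Subset n} → M ↭ e ∷ M₁ →
  degSum M e ≡ ∣ e ∣ + sum (map (λ g → ∣ e ∩ g ∣) M₁)
degSum-↭∷ {M = M} {M₁} {e} M↭eM₁ = begin
  degSum M e                    ≡⟨ degSum≡sum M e ⟩
  sum (map (∣_∣ ∘ (e ∩_)) M)    ≡⟨ sum-↭ (↭-map⁺ _ M↭eM₁) ⟩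
  ∣ e ∩ e ∣ + sum-M₁            ≡⟨ cong ((_+ sum-M₁) ∘ ∣_∣) (∩-idem e) ⟩
  ∣ e ∣ + sum-M₁                ∎
  where
  open ≡-Reasoning
  sum-M₁ : ℕ
  sum-M₁ = sum (map (λ g → ∣ e ∩ g ∣) M₁)

degSum≤∣e∣+1⇒↭∷∷disjoint : {M : List (Subset n)} {e : Subset n} →
  e ∈ M → 2 ≤ length M → degSum M e ≤ ∣ e ∣ + 1 →
  ∃₂ λ f M₂ → M ↭ e ∷ f ∷ M₂ × All (λ g → ∣ e ∩ g ∣ ≡ 0) M₂
degSum≤∣e∣+1⇒↭∷∷disjoint {e = e} e∈M 2≤∣M∣ degSum≤ with M₁ , M↭eM₁ ← ∈⇒↭∷ e∈M =
  let f , M₂ , M₁↭fM₂ , e∩M₂≡0 = sum≤1⇒↭∷zeros (λ g → ∣ e ∩ g ∣) M₁ 0<∣M₁∣ sum≤1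
  in f , M₂ , ↭-trans M↭eM₁ (↭-prep e M₁↭fM₂) , e∩M₂≡0
  where
  0<∣M₁∣ : 0 < length M₁
  0<∣M₁∣ = s≤s⁻¹ (subst (2 ≤_) (↭-length M↭eM₁) 2≤∣M∣)
  sum≤1 : sum (map (λ g → ∣ e ∩ g ∣) M₁) ≤ 1
  sum≤1 = +-cancelˡ-≤ ∣ e ∣ _ _ (subst (_≤ ∣ e ∣ + 1) (degSum-↭∷ M↭eM₁) degSum≤)

Apart : Subset n → Subset n → Set
Apart h k = ∣ h ∩ k ∣ < 2

Apart? : (h k : Subset n) → Dec (Apart h k)
Apart? h k = ∣ h ∩ k ∣ <? 2

Apart-sym : (h k : Subset n) → Apart h k → Apart k h
Apart-sym h k = subst (_< 2) (cong ∣_∣ (∩-comm h k))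

All-Apart? : (K : List (Subset n)) (h : Subset n) → Dec (All (Apart h) K)
All-Apart? K h = All.all? (Apart? h) K

apartFrom : Hyp3 n → List (Subset n) → Hyp3 n
apartFrom H K = record
  { edges   = filter (All-Apart? K) (edges H)
  ; uniform = Allₚ.filter⁺ (All-Apart? K) (uniform H)
  }

∣edge∣≡3 : (H : Hyp3 n) {h : Subset n} → InH H h → ∣ h ∣ ≡ 3
∣edge∣≡3 H = All.lookup (uniform H)

isMaxTwoMatching⇒NuTwo : {H : Hyp3 n} {M : List (Subset n)} →
  IsMaxTwoMatching H M → NuTwo H (length M)
isMaxTwoMatching⇒NuTwo {M = M} (M-matching , M-max) = (M , M-matching , refl) , M-max

isMaxTwoMatching-apartFrom : {H : Hyp3 n} {M M₂ : List (Subset n)} (K : List (Subset n)) →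
  IsMaxTwoMatching H M → M ↭ K ++ M₂ → IsMaxTwoMatching (apartFrom H K) M₂
isMaxTwoMatching-apartFrom {H = H} {M} {M₂} K ((M⊆H , M-apart) , M-max) M↭KM₂
  with M₂-apart , K-apart , M₂-K-apart ← AllPairs-++⁻ M₂
         (AllPairs-resp-↭ (λ {h} {k} → Apart-sym h k) (↭-trans M↭KM₂ (++-comm K M₂)) M-apart) =
  (M₂⊆H′ , M₂-apart) , maximal
  where
  M↭M₂K : M ↭ M₂ ++ K
  M↭M₂K = ↭-trans M↭KM₂ (++-comm K M₂)
  M₂K⊆H : All (InH H) (M₂ ++ K)
  M₂K⊆H = All-resp-↭ M↭M₂K M⊆H
  M₂⊆H′ : All (InH (apartFrom H K)) M₂
  M₂⊆H′ = All.zipWith (λ (g∈H , g-K) → ∈-filter⁺ (All-Apart? K) g∈H g-K)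
                      (Allₚ.++⁻ˡ M₂ M₂K⊆H , M₂-K-apart)
  maximal : ∀ M′ → IsTwoMatching (apartFrom H K) M′ → length M′ ≤ length M₂
  maximal M′ (M′⊆H′ , M′-apart) = +-cancelʳ-≤ (length K) _ _ (begin
    length M′ + length K   ≡⟨ length-++ M′ ⟨
    length (M′ ++ K)       ≤⟨ M-max (M′ ++ K) (M′K⊆H , M′K-apart) ⟩
    length M               ≡⟨ ↭-length M↭M₂K ⟩
    length (M₂ ++ K)       ≡⟨ length-++ M₂ ⟩
    length M₂ + length K   ∎)
    where
    open ≤-Reasoning
    M′-in-H : All (λ h → InH H h × All (Apart h) K) M′
    M′-in-H = All.map (∈-filter⁻ (All-Apart? K)) M′⊆H′
    M′K⊆H : All (InH H) (M′ ++ K)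
    M′K⊆H = Allₚ.++⁺ (All.map proj₁ M′-in-H) (Allₚ.++⁻ʳ M₂ M₂K⊆H)
    M′K-apart : AllPairs Apart (M′ ++ K)
    M′K-apart = AllPairs.++⁺ M′-apart K-apart (All.map proj₂ M′-in-H)

S⁺ : {H : Hyp3 n} {M M₂ : List (Subset n)} {e f h : Subset n} →
  M ↭ e ∷ f ∷ M₂ → All (λ g → ∣ e ∩ g ∣ ≡ 0) M₂ →
  InH H h → 2 ≤ ∣ e ∩ h ∣ → Apart h f → S H M e h
S⁺ {H = H} {M} {e = e} {h = h} M↭efM₂ e∩M₂≡0 h∈H 2≤∣e∩h∣ h-f = h∈H , 2≤∣e∩h∣ , apart
  where
  apart : ∀ g → g ∈ M → ¬ g ≡ e → Apart h g
  apart g g∈M g≢e with ∈-resp-↭ M↭efM₂ g∈M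
  ... | here refl = ⊥-elim (g≢e refl)
  ... | there (here refl) = h-f
  ... | there (there g∈M₂) = s≤s⁻¹ (begin
    2 + ∣ h ∩ g ∣          ≤⟨ +-monoˡ-≤ _ 2≤∣e∩h∣ ⟩
    ∣ e ∩ h ∣ + ∣ h ∩ g ∣  ≤⟨ ∣p∩q∣+∣q∩r∣≤∣q∣+∣p∩r∣ e h g ⟩
    ∣ h ∣ + ∣ e ∩ g ∣      ≡⟨ cong₂ _+_ (∣edge∣≡3 H h∈H) (All.lookup e∩M₂≡0 g∈M₂) ⟩
    3                      ∎)
    where open ≤-Reasoning

isTwoCover-++-facets : {H : Hyp3 n} {M M₂ C C′ : List (Subset n)} {e f : Subset n} →
  M ↭ e ∷ f ∷ M₂ → All (λ g → ∣ e ∩ g ∣ ≡ 0) M₂ → ∣ f ∣ ≡ 3 →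
  IsTwoCover (S H M e) C → IsTwoCover (InH (apartFrom H (e ∷ f ∷ []))) C′ →
  IsTwoCover (InH H) (C ++ facets f ++ C′)
isTwoCover-++-facets {H = H} {C = C} {C′} {e} {f} M↭efM₂ e∩M₂≡0 ∣f∣≡3
  (C-pairs , C-covers) (C′-pairs , C′-covers) =
  Allₚ.++⁺ C-pairs (Allₚ.++⁺ facets-pairs C′-pairs) , covers
  where
  facets-pairs : All (λ c → ∣ c ∣ ≡ 2) (facets f)
  facets-pairs = All.map (λ suc∣c∣≡∣f∣ → suc-injective (trans suc∣c∣≡∣f∣ ∣f∣≡3)) (suc∣facet∣≡∣p∣ f)
  covers : ∀ h → InH H h → Any (_⊆ h) (C ++ facets f ++ C′)
  covers h h∈H with Apart? h f | Apart? h e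
  ... | no ¬h-f | _ =
    Anyₚ.++⁺ʳ C (Anyₚ.++⁺ˡ (facets-cover f h ∣f∣≤1+∣f∩h∣ (subst (0 <_) (sym ∣f∣≡3) (s≤s z≤n))))
    where
    ∣f∣≤1+∣f∩h∣ : ∣ f ∣ ≤ suc ∣ f ∩ h ∣
    ∣f∣≤1+∣f∩h∣ = subst (_≤ suc ∣ f ∩ h ∣) (sym ∣f∣≡3) (s≤s (≮⇒≥ (¬h-f ∘ Apart-sym f h)))
  ... | yes h-f | yes h-e =
    Anyₚ.++⁺ʳ C (Anyₚ.++⁺ʳ (facets f) (C′-covers h (∈-filter⁺ (All-Apart? _) h∈H (h-e ∷ h-f ∷ []))))
  ... | yes h-f | no ¬h-e =
    Anyₚ.++⁺ˡ (C-covers h (S⁺ {H = H} M↭efM₂ e∩M₂≡0 h∈H (≮⇒≥ (¬h-e ∘ Apart-sym e h)) h-f))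

length-++-facets : (C : List (Subset n)) (f : Subset n) (C′ : List (Subset n)) →
  length C ≡ 1 → ∣ f ∣ ≡ 3 → length (C ++ facets f ++ C′) ≡ 4 + length C′
length-++-facets C f C′ ∣C∣≡1 ∣f∣≡3 = begin
  length (C ++ facets f ++ C′)               ≡⟨ length-++ C ⟩
  length C + length (facets f ++ C′)         ≡⟨ cong (length C +_) (length-++ (facets f)) ⟩
  length C + (length (facets f) + length C′)
    ≡⟨ cong₂ (λ a b → a + (b + length C′)) ∣C∣≡1 (trans (length-facets f) ∣f∣≡3) ⟩
  4 + length C′                              ∎
  where open ≡-Reasoning

q*[a+c]≤a*q+k*p : ∀ a q c p k → q * c ≤ p * k → q * (a + c) ≤ a * q + k * p
q*[a+c]≤a*q+k*p a q c p k qc≤pk = begin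
  q * (a + c)    ≡⟨ *-distribˡ-+ q a c ⟩
  q * a + q * c  ≤⟨ +-mono-≤ (≤-reflexive (*-comm q a)) (≤-trans qc≤pk (≤-reflexive (*-comm p k))) ⟩
  a * q + k * p  ∎
  where open ≤-Reasoning

lemma4 : ∀ {n} (H : Hyp3 n) (M : List (Subset n)) (ν : ℕ) →
    IsMaxTwoMatching H M → length M ≡ ν → 3 ≤ ν →
    (e : Subset n) → e ∈ M → degSum M e ≤ 4 → TauTwo (S H M e) 1 →
    ∀ (p q : ℕ) → GUpperBound (ν ∸ 2) p q →
    Σ (List (Subset n)) (λ C → IsTwoCover (InH H) C × q * length C ≤ 4 * q + (ν ∸ 2) * p)
lemma4 H M _ isMax@((M⊆H , _) , _) refl 3≤ν e e∈M degSum≤4 ((C , C-cover , ∣C∣≡1) , _) p q bound =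
  let f , M₂ , M↭efM₂ , e∩M₂≡0 =
        degSum≤∣e∣+1⇒↭∷∷disjoint e∈M (≤-trans (n≤1+n 2) 3≤ν) degSum≤∣e∣+1
      H₂ : Hyp3 _
      H₂ = apartFrom H (e ∷ f ∷ [])
      ν₂ : NuTwo H₂ (length M ∸ 2)
      ν₂ = subst (NuTwo H₂) (cong (_∸ 2) (sym (↭-length M↭efM₂)))
             (isMaxTwoMatching⇒NuTwo {H = H₂}
               (isMaxTwoMatching-apartFrom {H = H} (e ∷ f ∷ []) isMax M↭efM₂))
      C′ , C′-cover , C′-bound = bound _ H₂ ν₂
      ∣f∣≡3 : ∣ f ∣ ≡ 3
      ∣f∣≡3 = ∣edge∣≡3 H (All.lookup M⊆H (∈-resp-↭ (↭-sym M↭efM₂) (there (here refl))))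
  in C ++ facets f ++ C′ ,
     isTwoCover-++-facets {H = H} M↭efM₂ e∩M₂≡0 ∣f∣≡3 C-cover C′-cover ,
     subst (λ l → q * l ≤ _) (sym (length-++-facets C f C′ ∣C∣≡1 ∣f∣≡3))
       (q*[a+c]≤a*q+k*p 4 q _ p _ C′-bound)
  where
  degSum≤∣e∣+1 : degSum M e ≤ ∣ e ∣ + 1
  degSum≤∣e∣+1 =
    subst (λ k → degSum M e ≤ k + 1) (sym (∣edge∣≡3 H (All.lookup M⊆H e∈M))) degSum≤4
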